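{- There exists an algorithm (in the exploration model described in the context) that successfully explores every finite tree and that only ever assigns nonzero colors from the set $\{1,2,3\}$; in particular, it uses at most $3$ colors on every tree.
   Context: Exploration model. Graphs are finite, simple, undirected and connected; vertices are anonymous and edges carry no port labels. Each vertex carries a color in $\mathbb{N}=\{0,1,2,\dots\}$, where $0$ means "uncolored"; initially all vertices have color $0$. An algorithm is a function $\mathrm{move}$ mapping every environment $(c_0,E)$ — where $c_0\in\mathbb{N}$ is the color of the agent's current vertex and $E:\mathbb{N}\to\mathbb{N}$ (zero almost everywhere) gives, for each color $c$, the number $E(c)$ of neighbors of the current vertex having color $c$ — either to $\mathrm{Stop}$ or to a pair $(c_1,d)\in\mathbb{N}\times\mathbb{N}$ with $E(d)>0$, subject to $c_1=c_0$ whenever $c_0\neq 0$ (a vertex may only be colored while it is uncolored). A run on a graph $G$: an adversary chooses a start vertex $v_0$ and places the agent there; in each step, with the agent at $v$, $\mathrm{move}$ is evaluated at the environment of $v$; if the value is $\mathrm{Stop}$ the run ends, and if it is $(c_1,d)$ then $v$ receives color $c_1$ and the adversary chooses an arbitrary neighbor of $v$ of color $d$, to which the agent moves. The agent has no other memory (in particular it does not know through which edge it arrived). A vertex is visited if the agent is located at it in some step. An algorithm successfully explores $G$ if for every adversary (every choice of start vertex and of neighbors), after finitely many steps all vertices have been visited, the agent is at $v_0$, and the decision is $\mathrm{Stop}$. The number of colors used in a run is the number of distinct nonzero colors assigned during the run; the algorithm uses at most $m$ colors on $G$ if every run on $G$ uses at most $m$ colors. -}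

module Defs where

open import Data.Nat using (ℕ; zero; suc; _+_; _≤_; _<_; _≡ᵇ_)
open import Data.Fin using (Fin; zero; suc; _≟_)
open import Data.Bool using (Bool; true; false; if_then_else_; _∧_)
open import Data.List using (List; []; _∷_; _++_; length)
open import Data.List.Relation.Unary.Unique.Propositional using (Unique)
open import Data.List.Relation.Unary.Linked using (Linked)
open import Data.Product using (Σ; ∃; _×_; _,_)
open import Function using (_∘_)
open import Relation.Binary.PropositionalEquality using (_≡_; _≢_)
open import Relation.Nullary using (¬_)
open import Relation.Nullary.Decidable using (⌊_⌋)
open import Relation.Binary.Construct.Closure.ReflexiveTransitive using (Star)
open import Induction.WellFounded using (Acc)

record Graph : Set where
  field
    n          : ℕ
    adj        : Fin n → Fin n → Bool
    adj-sym    : ∀ u v → adj u v ≡ adj v u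
    adj-irrefl : ∀ v → adj v v ≡ false

module _ (G : Graph) where
  open Graph G

  Adj : Fin n → Fin n → Set
  Adj u v = adj u v ≡ true

  data Walk : Fin n → Fin n → Set where
    here : ∀ {v} → Walk v v
    step : ∀ {u v w} → Adj u v → Walk v w → Walk u w

  Connected : Set
  Connected = ∀ u v → Walk u v

  Cycle : Set
  Cycle = Σ (Fin n) λ x → Σ (List (Fin n)) λ rest →
            (2 ≤ length rest) × Unique (x ∷ rest) × Linked Adj (x ∷ rest ++ (x ∷ []))

  Acyclic : Set
  Acyclic = ¬ Cycle

  Tree : Set
  Tree = Connected × Acyclic

Environment : Set
Environment = ℕ → ℕ

FiniteSupport : Environment → Set
FiniteSupport E = ∃ λ b → ∀ c → b ≤ c → E c ≡ 0

data Decision : Set where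
  stop : Decision
  go   : ℕ → ℕ → Decision      -- go c₁ d : colour current vertex c₁, move to a neighbour of colour d

record Algorithm : Set where
  field
    move       : ℕ → Environment → Decision
    move-valid : ∀ c₀ E c₁ d → FiniteSupport E → move c₀ E ≡ go c₁ d →
                 (0 < E d) × (c₀ ≢ 0 → c₁ ≡ c₀)

count : ∀ {m} → (Fin m → Bool) → ℕ
count {zero}  f = 0
count {suc m} f = (if f zero then 1 else 0) + count (f ∘ suc)

update : ∀ {m} {A : Set} → (Fin m → A) → Fin m → A → Fin m → A
update f v x w = if ⌊ w ≟ v ⌋ then x else f w

module _ (A : Algorithm) (G : Graph) where
  open Algorithm A
  open Graph G

  env : (Fin n → ℕ) → Fin n → Environment
  env col v c = count (λ w → adj v w ∧ (col w ≡ᵇ c))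

  record State : Set where
    constructor ⟨_,_,_⟩
    field
      color   : Fin n → ℕ
      pos     : Fin n
      visited : Fin n → Bool
  open State public

  decision : State → Decision
  decision s = move (color s (pos s)) (env (color s) (pos s))

  initial : Fin n → State
  initial v₀ = ⟨ (λ _ → 0) , v₀ , update (λ _ → false) v₀ true ⟩

  -- one step, with the adversary choosing any neighbour w of the required colour
  data Step (s : State) : State → Set where
    step : ∀ {c₁ d w} → decision s ≡ go c₁ d → Adj G (pos s) w →
           update (color s) (pos s) c₁ w ≡ d →
           Step s ⟨ update (color s) (pos s) c₁ , w , update (visited s) w true ⟩

  Reachable : State → State → Set
  Reachable = Star Step

  -- no infinite run (for any adversary) starting from s
  AllRunsFinite : State → Set
  AllRunsFinite = Acc (λ s' s → Step s s')

  SuccessfullyExplores : Set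
  SuccessfullyExplores = ∀ v₀ →
      AllRunsFinite (initial v₀)
    × (∀ s → Reachable (initial v₀) s → decision s ≡ stop →
         (pos s ≡ v₀) × (∀ w → visited s w ≡ true))

  ColorsWithin3 : Set
  ColorsWithin3 = ∀ v₀ s → Reachable (initial v₀) s → ∀ w → color s w ≤ 3

module Submission where

-- The algorithm is a depth-first search in which a vertex at depth d of the search tree is
-- coloured 1 + (d mod 3). A vertex of colour c then recognises its parent as its unique
-- neighbour of colour prev c (its children all have colour next c), so the agent can backtrack
-- without memory, and a vertex being entered reads its own colour off its parent, which is its
-- only coloured neighbour. Both uniqueness claims are where acyclicity is used: any other
-- coloured neighbour would close a cycle with the tree paths through the stack of ancestors.
-- Each move either visits a new vertex (pushing one onto the stack) or pops the stack, so
-- 2 · #unvisited + |stack| decreases and every run is finite. The search stops only back at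
-- the root with no uncoloured vertex adjacent to a coloured one, hence, by connectivity, with
-- every vertex visited.

open import Data.Bool using (Bool; true; false; not; _∧_; if_then_else_)
open import Data.Bool.Properties using (T-≡; T-∧)
open import Data.Empty using (⊥; ⊥-elim)
open import Data.Fin using (Fin; zero; suc; _≟_)
open import Data.Fin.Properties using (suc-injective)
open import Data.List using (List; []; _∷_; _++_; length; head)
open import Data.List.Membership.Propositional using (_∈_; _∉_)
open import Data.List.Membership.Propositional.Properties using (∈-++⁺ʳ; ∈-++⁻)
open import Data.List.Relation.Unary.All as All using (All; []; _∷_)
open import Data.List.Relation.Unary.All.Properties using (¬Any⇒All¬)
open import Data.List.Relation.Unary.AllPairs using ([]; _∷_)
open import Data.List.Relation.Unary.Any using (here; there)
open import Data.List.Relation.Unary.Linked using (Linked; []; [-]; _∷_)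
open import Data.List.Relation.Unary.Unique.Propositional using (Unique)
open import Data.Maybe using (just)
open import Data.Maybe.Properties using (just-injective)
open import Data.Nat as ℕ using (ℕ; zero; suc; _+_; _*_; _≤_; _<_; z≤n; s≤s; _≡ᵇ_)
open import Data.Nat.Induction using (<-wellFounded)
open import Data.Nat.Properties
  using (≤-refl; ≤-reflexive; ≤-trans; <-trans; <-irrefl; <-asym; m≤n+m; +-suc; +-monoʳ-<;
         ≮⇒≥; n≤0⇒n≡0; ≡ᵇ⇒≡; ≡⇒≡ᵇ)
open import Data.Nat.Tactic.RingSolver using (solve-∀)
open import Data.Product using (Σ; ∃; _×_; _,_; proj₁; proj₂)
open import Data.Sum using (_⊎_; inj₁; inj₂)
open import Data.Sum.Function.Propositional using (_⊎-⇔_)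
open import Function using (_∘_; _⇔_; mk⇔; Equivalence; case_of_)
open import Function.Construct.Composition using (_⇔-∘_)
open import Function.Construct.Identity using (⇔-id)
open import Function.Construct.Symmetry using (⇔-sym)
open import Induction.WellFounded using (Acc; acc)
open import Relation.Binary.Construct.Closure.ReflexiveTransitive using (ε; _◅_)
open import Relation.Binary.PropositionalEquality
open import Relation.Nullary using (¬_; Dec; yes; no)

open import Defs

open Equivalence using (to; from)

next : ℕ → ℕ
next 1 = 2
next 2 = 3
next _ = 1

prev : ℕ → ℕ
prev 1 = 3
prev 2 = 1
prev 3 = 2
prev _ = 0

data Colour : ℕ → Set where
  one   : Colour 1
  two   : Colour 2
  three : Colour 3

shade : ℕ → ℕ
shade zero    = 1
shade (suc d) = next (shade d)

next-colour : ∀ {k} → Colour k → Colour (next k)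
next-colour one   = two
next-colour two   = three
next-colour three = one

shade-colour : ∀ d → Colour (shade d)
shade-colour zero    = one
shade-colour (suc d) = next-colour (shade-colour d)

colour≢0 : ∀ {k} → Colour k → k ≢ 0
colour≢0 one   ()
colour≢0 two   ()
colour≢0 three ()

colour≤3 : ∀ {k} → Colour k → k ≤ 3
colour≤3 one   = s≤s z≤n
colour≤3 two   = s≤s (s≤s z≤n)
colour≤3 three = s≤s (s≤s (s≤s z≤n))

prev-colour : ∀ {k} → Colour k → Colour (prev k)
prev-colour one   = three
prev-colour two   = one
prev-colour three = two

prev-next : ∀ {k} → Colour k → prev (next k) ≡ k
prev-next one   = refl
prev-next two   = refl
prev-next three = refl

next≢prev : ∀ {k} → Colour k → next k ≢ prev k
next≢prev one   ()
next≢prev two   ()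
next≢prev three ()

-- The colour an uncoloured vertex takes, from the numbers of its neighbours coloured 1 and 2:
-- the next colour after that of its only coloured neighbour, and 1 if it has none.
freshColour : ℕ → ℕ → ℕ
freshColour (suc _) _       = 2
freshColour zero    (suc _) = 3
freshColour zero    zero    = 1

colourAt : ℕ → Environment → ℕ
colourAt zero       E = freshColour (E 1) (E 2)
colourAt c₀@(suc _) E = c₀

-- dfs c u b: own colour c, u uncoloured neighbours, b neighbours of the parent colour prev c.
dfs : ℕ → ℕ → ℕ → Decision
dfs c (suc _) _       = go c 0
dfs c zero    (suc _) = go c (prev c)
dfs c zero    zero    = stop

dfsMove : ℕ → Environment → Decision
dfsMove c₀ E = dfs (colourAt c₀ E) (E 0) (E (prev (colourAt c₀ E)))

data DfsGo (c u b : ℕ) : ℕ → ℕ → Set where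
  descend : 0 < u → DfsGo c u b c 0
  ascend  : u ≡ 0 → 0 < b → DfsGo c u b c (prev c)

dfs-go : ∀ c u b {c₁ d} → dfs c u b ≡ go c₁ d → DfsGo c u b c₁ d
dfs-go c (suc u) b       refl = descend (s≤s z≤n)
dfs-go c zero    (suc b) refl = ascend refl (s≤s z≤n)

dfs-stop : ∀ c u b → dfs c u b ≡ stop → u ≡ 0 × b ≡ 0
dfs-stop c zero zero refl = refl , refl

colourAt-coloured : ∀ {c₀} E → c₀ ≢ 0 → colourAt c₀ E ≡ c₀
colourAt-coloured {zero}  E c₀≢0 = ⊥-elim (c₀≢0 refl)
colourAt-coloured {suc _} E _    = refl

dfsMove-valid : ∀ c₀ E c₁ d → FiniteSupport E → dfsMove c₀ E ≡ go c₁ d →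
                (0 < E d) × (c₀ ≢ 0 → c₁ ≡ c₀)
dfsMove-valid c₀ E c₁ d _ eq with dfs-go _ _ _ eq
... | descend 0<u  = 0<u , colourAt-coloured E
... | ascend _ 0<b = 0<b , colourAt-coloured E

dfs-algorithm : Algorithm
dfs-algorithm = record { move = dfsMove ; move-valid = dfsMove-valid }

only-colour⇒absent : ∀ {k} (E : Environment) → (∀ c → c ≢ 0 → 0 < E c → c ≡ k) →
                     ∀ c → c ≢ 0 → c ≢ k → E c ≡ 0
only-colour⇒absent E only c c≢0 c≢k = n≤0⇒n≡0 (≮⇒≥ (c≢k ∘ only c c≢0))

freshColour-next : ∀ {k} → Colour k → (E : Environment) → 0 < E k →
                   (∀ c → c ≢ 0 → 0 < E c → c ≡ k) → freshColour (E 1) (E 2) ≡ next k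
freshColour-next one E 0<E1 _ with E 1 | 0<E1
... | suc _ | _ = refl
freshColour-next two E 0<E2 only rewrite only-colour⇒absent E only 1 (λ ()) (λ ()) with E 2 | 0<E2
... | suc _ | _ = refl
freshColour-next three E _ only
  rewrite only-colour⇒absent E only 1 (λ ()) (λ ()) | only-colour⇒absent E only 2 (λ ()) (λ ()) = refl

count-cong : ∀ {m} {f g : Fin m → Bool} → (∀ w → f w ≡ g w) → count f ≡ count g
count-cong {zero}  f≗g = refl
count-cong {suc m} f≗g =
  cong₂ (λ b k → (if b then 1 else 0) + k) (f≗g zero) (count-cong (f≗g ∘ suc))

count-pos : ∀ {m} (f : Fin m → Bool) {w} → f w ≡ true → 0 < count f
count-pos f {zero}  fw rewrite fw = s≤s z≤n
count-pos f {suc w} fw = ≤-trans (count-pos (f ∘ suc) fw) (m≤n+m _ _)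

count-pos⁻ : ∀ {m} (f : Fin m → Bool) → 0 < count f → ∃ λ w → f w ≡ true
count-pos⁻ {suc m} f 0<count with f zero in fzero
... | true  = zero , fzero
... | false = let w , fw = count-pos⁻ (f ∘ suc) 0<count in suc w , fw

count-drop : ∀ {m} {f g : Fin m → Bool} {w} → f w ≡ true → g w ≡ false →
             (∀ v → v ≢ w → f v ≡ g v) → count f ≡ suc (count g)
count-drop {suc m} {f} {g} {zero} fw gw f≗g rewrite fw | gw =
  cong suc (count-cong (λ v → f≗g (suc v) (λ ())))
count-drop {suc m} {f} {g} {suc w} fw gw f≗g rewrite f≗g zero (λ ()) =
  trans (cong (_ +_) (count-drop fw gw (λ v v≢w → f≗g (suc v) (v≢w ∘ suc-injective))))
        (+-suc _ _)

update-≡ : ∀ {m} {A : Set} (f : Fin m → A) v x → update f v x v ≡ x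
update-≡ f v x with v ≟ v
... | yes _  = refl
... | no v≢v = ⊥-elim (v≢v refl)

update-≢ : ∀ {m} {A : Set} (f : Fin m → A) {v} x {w} → w ≢ v → update f v x w ≡ f w
update-≢ f {v} x {w} w≢v with w ≟ v
... | yes w≡v = ⊥-elim (w≢v w≡v)
... | no _    = refl

update-redundant : ∀ {m} {A : Set} (f : Fin m → A) {v x} → f v ≡ x → ∀ w →
                   update f v x w ≡ f w
update-redundant f {v} fv≡x w with w ≟ v
... | yes refl = sym fv≡x
... | no _     = refl

update-true : ∀ {m} (f : Fin m → Bool) q v → update f q true v ≡ true ⇔ (f v ≡ true ⊎ v ≡ q)
update-true f q v with v ≟ q
... | yes v≡q = mk⇔ (λ _ → inj₂ v≡q) (λ _ → refl)
... | no v≢q  = mk⇔ inj₁ λ { (inj₁ fv) → fv ; (inj₂ v≡q) → ⊥-elim (v≢q v≡q) }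

module _ (G : Graph) where
  open Graph G

  Adj-sym : ∀ {u v} → Adj G u v → Adj G v u
  Adj-sym {u} {v} uv = trans (adj-sym v u) uv

  Adj⇒≢ : ∀ {u v} → Adj G u v → u ≢ v
  Adj⇒≢ {u} uu refl with trans (sym uu) (adj-irrefl u)
  ... | ()

  neighbour-of-colour : ∀ (col : Fin n → ℕ) {v w c} →
                        adj v w ∧ (col w ≡ᵇ c) ≡ true ⇔ (Adj G v w × col w ≡ c)
  neighbour-of-colour col = mk⇔
    (λ e → let a , b = to T-∧ (from T-≡ e) in to T-≡ a , ≡ᵇ⇒≡ _ _ b)
    (λ (a , b) → to T-≡ (from T-∧ (from T-≡ a , ≡⇒≡ᵇ _ _ b)))

  module _ (A : Algorithm) where

    env-pos : ∀ col {v w c} → Adj G v w → col w ≡ c → 0 < env A G col v c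
    env-pos col {v} {c = c} vw cw =
      count-pos (λ u → adj v u ∧ (col u ≡ᵇ c)) (from (neighbour-of-colour col) (vw , cw))

    env-pos⁻ : ∀ col {v c} → 0 < env A G col v c → ∃ λ w → Adj G v w × col w ≡ c
    env-pos⁻ col 0<env = let w , e = count-pos⁻ _ 0<env in w , to (neighbour-of-colour col) e

    env-zero : ∀ col {v w c} → env A G col v c ≡ 0 → Adj G v w → col w ≢ c
    env-zero col env≡0 vw cw = <-irrefl (sym env≡0) (env-pos col vw cw)

module _ {A : Set} where

  prefixThrough : {x : A} {xs : List A} → x ∈ xs → List A
  prefixThrough {xs = y ∷ _} (here _)  = y ∷ []
  prefixThrough {xs = y ∷ _} (there m) = y ∷ prefixThrough m

  1≤length-prefixThrough : {x : A} {xs : List A} (m : x ∈ xs) → 1 ≤ length (prefixThrough m)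
  1≤length-prefixThrough (here _)  = s≤s z≤n
  1≤length-prefixThrough (there _) = s≤s z≤n

  prefixThrough-⊆ : {x v : A} {xs : List A} (m : x ∈ xs) → v ∈ prefixThrough m → v ∈ xs
  prefixThrough-⊆ (here _)  (here v≡y)  = here v≡y
  prefixThrough-⊆ (there _) (here v≡y)  = here v≡y
  prefixThrough-⊆ (there m) (there v∈) = there (prefixThrough-⊆ m v∈)

  prefixThrough-unique : {x : A} {xs : List A} → Unique xs → (m : x ∈ xs) → Unique (prefixThrough m)
  prefixThrough-unique (_ ∷ _)     (here _)  = [] ∷ []
  prefixThrough-unique (y∉ys ∷ ys!) (there m) =
    All.tabulate (All.lookup y∉ys ∘ prefixThrough-⊆ m) ∷ prefixThrough-unique ys! m

  prefixThrough-linked : {R : A → A → Set} {x b : A} {xs : List A} → Linked R xs →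
                         (m : x ∈ xs) → R x b → Linked R (prefixThrough m ++ b ∷ [])
  prefixThrough-linked _          (here refl)         xb = xb ∷ [-]
  prefixThrough-linked (r ∷ rxs)  (there m@(here _))  xb = r ∷ prefixThrough-linked rxs m xb
  prefixThrough-linked (r ∷ rxs)  (there m@(there _)) xb = r ∷ prefixThrough-linked rxs m xb

  lastOr : A → List A → A
  lastOr x []       = x
  lastOr _ (y ∷ ys) = lastOr y ys

  lastOr-∈ : ∀ x xs → lastOr x xs ∈ x ∷ xs
  lastOr-∈ x []       = here refl
  lastOr-∈ _ (y ∷ ys) = there (lastOr-∈ y ys)

module _ (G : Graph) (acyclic : Acyclic G) where

  no-chord : ∀ {x z Q} → Unique (x ∷ Q) → Linked (Adj G) (x ∷ Q) → z ∈ Q →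
             head Q ≢ just z → ¬ Adj G x z
  no-chord _ _ (here refl) z-not-head _ = z-not-head refl
  no-chord {x} {Q = y ∷ P} xQ! xQ-path (there z∈P) _ xz =
    acyclic ( x , y ∷ prefixThrough z∈P , s≤s (1≤length-prefixThrough z∈P)
            , prefixThrough-unique xQ! (there (there z∈P))
            , prefixThrough-linked xQ-path (there (there z∈P)) (Adj-sym G xz))

  adjacent-on-path⇒head : ∀ {p w T} → Unique (p ∷ T) → Linked (Adj G) (p ∷ T) → Adj G p w →
                          w ∈ T → head T ≡ just w
  adjacent-on-path⇒head _ _ _ (here refl) = refl
  adjacent-on-path⇒head pT!@(_ ∷ x∉T ∷ _) pT-path pw (there w∈T) =
    ⊥-elim (no-chord pT! pT-path (there w∈T) (All.lookup x∉T w∈T ∘ just-injective) pw)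

module Exploration (G : Graph) (acyclic : Acyclic G) (root : Fin (Graph.n G)) where
  open Graph G using (n)
  open import Data.List.Membership.DecPropositional (_≟_ {n}) using (_∈?_)

  DfsState : Set
  DfsState = State dfs-algorithm G

  environment : DfsState → Environment
  environment s = env dfs-algorithm G (color s) (pos s)

  ownColour : DfsState → ℕ
  ownColour s = colourAt (color s (pos s)) (environment s)

  moved : DfsState → ℕ → Fin n → DfsState
  moved s c w = ⟨ update (color s) (pos s) c , w , update (visited s) w true ⟩

  Coloured : (Fin n → ℕ) → Fin n → Set
  Coloured col v = col v ≢ 0

  Finished : (Fin n → ℕ) → List (Fin n) → Fin n → Set
  Finished col path v = Coloured col v × v ∉ path

  Reached : (Fin n → ℕ) → Fin n → Fin n → Set
  Reached col p v = Coloured col v ⊎ v ≡ p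

  DepthStep : (Fin n → ℕ) → Fin n → Fin n → Set
  DepthStep depth u v = depth u ≡ suc (depth v)

  ParentEdge : (Fin n → ℕ) → (Fin n → ℕ) → Fin n → Fin n → Set
  ParentEdge col depth v u = Adj G v u × Coloured col u × DepthStep depth v u

  -- The stack lists the ancestors of the current vertex, nearest first and ending at the root;
  -- the current vertex itself may still be uncoloured.
  record DfsInvariant (s : DfsState) : Set where
    field
      stack           : List (Fin n)
      stack-root      : lastOr (pos s) stack ≡ root
      stack-unique    : Unique (pos s ∷ stack)
      stack-path      : Linked (Adj G) (pos s ∷ stack)
      stack-coloured  : All (Coloured (color s)) stack
      depth           : Fin n → ℕ
      stack-depth     : Linked (DepthStep depth) (pos s ∷ stack)
      depth-root      : depth root ≡ 0
      colour-shade    : ∀ v → Coloured (color s) v → color s v ≡ shade (depth v)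
      parent          : Fin n → Fin n
      finished-parent : ∀ v → Finished (color s) (pos s ∷ stack) v →
                        ParentEdge (color s) depth v (parent v)
      finished-closed : ∀ v w → Finished (color s) (pos s ∷ stack) v → Adj G v w →
                        Coloured (color s) w
      visited-reached : ∀ v → visited s v ≡ true ⇔ Reached (color s) (pos s) v

  module Neighbourhood {s : DfsState} (I : DfsInvariant s) where
    open DfsInvariant I public

    private
      col = color s
      p   = pos s

    parent-below : ∀ {y} → Finished col (p ∷ stack) y → depth (parent y) < depth y
    parent-below y-fin = ≤-reflexive (sym (proj₂ (proj₂ (finished-parent _ y-fin))))

    -- Following parent pointers up from y traces a simple path y ∷ ac ++ p ∷ stack (depths
    -- strictly decrease along it), until a pointer into the stack makes a chord of that path.
    parent-chase : ∀ {y} ac → Acc _<_ (depth y) → Finished col (p ∷ stack) y →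
                   (ac ≡ [] → parent y ≢ p) → All (λ b → depth y < depth b) ac →
                   Unique (y ∷ ac ++ p ∷ stack) → Linked (Adj G) (y ∷ ac ++ p ∷ stack) → ⊥
    parent-chase {y} ac (acc rec) y-fin not-child deeper path! path = continue (parent y ∈? p ∷ stack)
      where
        y~par   = proj₁ (finished-parent y y-fin)
        par-col = proj₁ (proj₂ (finished-parent y y-fin))
        par<y   = parent-below y-fin

        not-head : ∀ ac → (ac ≡ [] → parent y ≢ p) → All (λ b → depth y < depth b) ac →
                   head (ac ++ p ∷ stack) ≢ just (parent y)
        not-head []      not-child _         eq = not-child refl (sym (just-injective eq))
        not-head (_ ∷ _) _         (y<a ∷ _) eq =
          <-asym par<y (subst (λ b → depth y < depth b) (just-injective eq) y<a)

        par≢ : parent y ∉ p ∷ stack → ∀ {e} → e ∈ y ∷ ac ++ p ∷ stack → parent y ≢ e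
        par≢ _    (here refl) = Adj⇒≢ G y~par ∘ sym
        par≢ par∉ (there e∈) with ∈-++⁻ ac e∈
        ... | inj₁ e∈ac    = λ { refl → <-asym par<y (All.lookup deeper e∈ac) }
        ... | inj₂ e∈stack = λ { refl → par∉ e∈stack }

        continue : Dec (parent y ∈ p ∷ stack) → ⊥
        continue (yes par∈) =
          no-chord G acyclic path! path (∈-++⁺ʳ ac par∈) (not-head ac not-child deeper) y~par
        continue (no par∉)  =
          parent-chase (y ∷ ac) (rec par<y) (par-col , par∉) (λ ())
            (par<y ∷ All.map (<-trans par<y) deeper) (All.tabulate (par≢ par∉) ∷ path!)
            (Adj-sym G y~par ∷ path)

    coloured-neighbour : ∀ {w} → Adj G p w → Coloured col w →
                         head stack ≡ just w ⊎ (Finished col (p ∷ stack) w × parent w ≡ p)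
    coloured-neighbour {w} p~w w-col with w ∈? p ∷ stack
    ... | yes (here w≡p) = ⊥-elim (Adj⇒≢ G p~w (sym w≡p))
    ... | yes (there w∈) = inj₁ (adjacent-on-path⇒head G acyclic stack-unique stack-path p~w w∈)
    ... | no w∉ with parent w ≟ p
    ...   | yes par≡p = inj₂ ((w-col , w∉) , par≡p)
    ...   | no par≢p  = ⊥-elim (parent-chase [] (<-wellFounded _) (w-col , w∉) (λ _ → par≢p) []
                                  (¬Any⇒All¬ _ w∉ ∷ stack-unique) (Adj-sym G p~w ∷ stack-path))

    uncoloured-neighbour : col p ≡ 0 → ∀ {w} → Adj G p w → Coloured col w → head stack ≡ just w
    uncoloured-neighbour p-unc p~w w-col with coloured-neighbour p~w w-col
    ... | inj₁ top            = top
    ... | inj₂ (w-fin , par≡p) =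
      ⊥-elim (proj₁ (proj₂ (finished-parent _ w-fin)) (trans (cong col par≡p) p-unc))

    parent-neighbour : ∀ {w} → Adj G p w → col w ≡ prev (shade (depth p)) → head stack ≡ just w
    parent-neighbour {w} p~w w-prev with coloured-neighbour p~w w-col
      where
        w-col : Coloured col w
        w-col = colour≢0 (prev-colour (shade-colour (depth p))) ∘ trans (sym w-prev)
    ... | inj₁ top            = top
    ... | inj₂ (w-fin , par≡p) =
      ⊥-elim (next≢prev (shade-colour (depth p)) (trans (sym child) w-prev))
      where
        child : col w ≡ next (shade (depth p))
        child = trans (colour-shade w (proj₁ w-fin))
                      (cong shade (trans (proj₂ (proj₂ (finished-parent w w-fin)))
                                         (cong (suc ∘ depth) par≡p)))

  module Recolouring (col : Fin n → ℕ) (p : Fin n) {c} (c≢0 : c ≢ 0) where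
    col′ : Fin n → ℕ
    col′ = update col p c

    coloured-here : Coloured col′ p
    coloured-here = c≢0 ∘ trans (sym (update-≡ col p c))

    stays-coloured : ∀ {v} → Coloured col v → Coloured col′ v
    stays-coloured {v} v-col with v ≟ p
    ... | yes _ = c≢0
    ... | no _  = v-col

    coloured-elsewhere : ∀ {v} → Coloured col′ v → v ≢ p → Coloured col v
    coloured-elsewhere v-col′ v≢p = v-col′ ∘ trans (update-≢ col c v≢p)

    coloured-or-here : ∀ {v} → Coloured col′ v → Reached col p v
    coloured-or-here {v} v-col′ with v ≟ p
    ... | yes v≡p = inj₂ v≡p
    ... | no _    = inj₁ v-col′

    reached : ∀ q v → Reached col′ q v ⇔ (Reached col p v ⊎ v ≡ q)
    reached q v = mk⇔ forth back
      where
        forth : Reached col′ q v → Reached col p v ⊎ v ≡ q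
        forth (inj₁ v-col′) = inj₁ (coloured-or-here v-col′)
        forth (inj₂ v≡q) = inj₂ v≡q
        back : Reached col p v ⊎ v ≡ q → Reached col′ q v
        back (inj₁ (inj₁ v-col)) = inj₁ (stays-coloured v-col)
        back (inj₁ (inj₂ refl))  = inj₁ coloured-here
        back (inj₂ v≡q)          = inj₂ v≡q

  moved-visited-reached : ∀ {s} (I : DfsInvariant s) {c} → c ≢ 0 → ∀ q v →
                          visited (moved s c q) v ≡ true ⇔ Reached (color (moved s c q)) q v
  moved-visited-reached {s} I c≢0 q v =
    ⇔-sym (Recolouring.reached (color s) (pos s) c≢0 q v)
      ⇔-∘ ((DfsInvariant.visited-reached I v ⊎-⇔ ⇔-id _) ⇔-∘ update-true (visited s) q v)

  freshColour-shade : ∀ {s} (I : DfsInvariant s) → color s (pos s) ≡ 0 →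
                      freshColour (environment s 1) (environment s 2)
                        ≡ shade (DfsInvariant.depth I (pos s))
  freshColour-shade {s} I@record { stack = [] ; stack-root = p≡root } p-unc =
    trans (cong₂ freshColour (absent 1 (λ ())) (absent 2 (λ ())))
          (cong shade (sym (trans (cong depth p≡root) depth-root)))
    where
      open Neighbourhood I
      absent : ∀ c → c ≢ 0 → environment s c ≡ 0
      absent c c≢0 = n≤0⇒n≡0 (≮⇒≥ λ 0<E →
        let w , p~w , w-c = env-pos⁻ G dfs-algorithm (color s) 0<E
        in case uncoloured-neighbour p-unc p~w (c≢0 ∘ trans (sym w-c)) of λ ())
  freshColour-shade {s} I@record { stack = x ∷ _ ; stack-path = p~x ∷ _ ; stack-coloured = x-col ∷ _
                                 ; stack-depth = p-step ∷ _ } p-unc =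
    trans (freshColour-next (shade-colour (depth x)) (environment s)
                            (env-pos G dfs-algorithm (color s) p~x (colour-shade x x-col)) only)
          (cong shade (sym p-step))
    where
      open Neighbourhood I
      only : ∀ c → c ≢ 0 → 0 < environment s c → c ≡ shade (depth x)
      only c c≢0 0<E with env-pos⁻ G dfs-algorithm (color s) 0<E
      ... | w , p~w , w-c with uncoloured-neighbour p-unc p~w (c≢0 ∘ trans (sym w-c))
      ...   | refl = trans (sym w-c) (colour-shade x x-col)

  ownColour-shade : ∀ {s} (I : DfsInvariant s) → ownColour s ≡ shade (DfsInvariant.depth I (pos s))
  ownColour-shade {s} I with color s (pos s) ℕ.≟ 0
  ... | yes p-unc = trans (cong (λ c → colourAt c (environment s)) p-unc) (freshColour-shade I p-unc)
  ... | no p-col  = trans (colourAt-coloured (environment s) p-col) (DfsInvariant.colour-shade I _ p-col)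

  ownColour≢0 : ∀ {s} (I : DfsInvariant s) → ownColour s ≢ 0
  ownColour≢0 {s} I =
    colour≢0 (shade-colour (DfsInvariant.depth I (pos s))) ∘ trans (sym (ownColour-shade I))

  unvisited : DfsState → ℕ
  unvisited s = count (not ∘ visited s)

  measure : ∀ {s} → DfsInvariant s → ℕ
  measure {s} I = 2 * unvisited s + length (DfsInvariant.stack I)

  suc[2u+1+L]≡2[1+u]+L : ∀ u L → suc (2 * u + suc L) ≡ 2 * suc u + L
  suc[2u+1+L]≡2[1+u]+L = solve-∀

  depth-update : ∀ {depth : Fin n → ℕ} {w k xs} → All (w ≢_) xs → Linked (DepthStep depth) xs →
                 Linked (DepthStep (update depth w k)) xs
  depth-update _                   []               = []
  depth-update _                   [-]              = [-]
  depth-update {depth} {k = k} (w≢x ∷ w≢ys@(w≢y ∷ _)) (x-step ∷ steps) =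
    trans (update-≢ depth k (w≢x ∘ sym))
          (trans x-step (cong suc (sym (update-≢ depth k (w≢y ∘ sym)))))
      ∷ depth-update w≢ys steps

  descend-step : ∀ {s w} (I : DfsInvariant s) → Adj G (pos s) w → color s w ≡ 0 →
                 Σ (DfsInvariant (moved s (ownColour s) w)) λ I′ → measure I′ < measure I
  descend-step {s} {w} I p~w w-unc = I′ , decrease
    where
      open Neighbourhood I
      open Recolouring (color s) (pos s) (ownColour≢0 I)
      depth′ = update depth w (suc (depth (pos s)))

      w∉ : w ∉ pos s ∷ stack
      w∉ (here refl) = Adj⇒≢ G p~w refl
      w∉ (there w∈)  = All.lookup stack-coloured w∈ w-unc

      ≢w : ∀ {v} → Coloured (color s) v → v ≢ w
      ≢w v-col refl = v-col w-unc

      depth′-coloured : ∀ {v} → Coloured (color s) v → depth′ v ≡ depth v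
      depth′-coloured = update-≢ depth _ ∘ ≢w

      depth′-pos : depth′ (pos s) ≡ depth (pos s)
      depth′-pos = update-≢ depth _ (Adj⇒≢ G p~w)

      colour-shade′ : ∀ v → Coloured col′ v → col′ v ≡ shade (depth′ v)
      colour-shade′ v v-col′ with v ≟ pos s
      ... | yes refl = trans (ownColour-shade I) (cong shade (sym depth′-pos))
      ... | no _     = trans (colour-shade v v-col′) (cong shade (sym (depth′-coloured v-col′)))

      finished⁻ : ∀ {v} → Finished col′ (w ∷ pos s ∷ stack) v →
                  Finished (color s) (pos s ∷ stack) v
      finished⁻ (v-col′ , v∉) = coloured-elsewhere v-col′ (v∉ ∘ there ∘ here) , v∉ ∘ there

      finished-parent′ : ∀ v → Finished col′ (w ∷ pos s ∷ stack) v → ParentEdge col′ depth′ v (parent v)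
      finished-parent′ v v-fin′ =
        let v-fin = finished⁻ v-fin′
            v~par , par-col , v-step = finished-parent v v-fin
        in v~par , stays-coloured par-col
           , trans (depth′-coloured (proj₁ v-fin))
                   (trans v-step (cong suc (sym (depth′-coloured par-col))))

      I′ : DfsInvariant (moved s (ownColour s) w)
      I′ = record
        { stack           = pos s ∷ stack
        ; stack-root      = stack-root
        ; stack-unique    = ¬Any⇒All¬ _ w∉ ∷ stack-unique
        ; stack-path      = Adj-sym G p~w ∷ stack-path
        ; stack-coloured  = coloured-here ∷ All.map stays-coloured stack-coloured
        ; depth           = depth′
        ; stack-depth     = trans (update-≡ depth w _) (cong suc (sym depth′-pos))
                              ∷ depth-update (¬Any⇒All¬ _ w∉) stack-depth
        ; depth-root      = trans (update-≢ depth _ root≢w) depth-root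
        ; colour-shade    = colour-shade′
        ; parent          = parent
        ; finished-parent = finished-parent′
        ; finished-closed = λ v u v-fin′ v~u →
                              stays-coloured (finished-closed v u (finished⁻ v-fin′) v~u)
        ; visited-reached = moved-visited-reached I (ownColour≢0 I) w
        }
        where
          root≢w : root ≢ w
          root≢w refl = w∉ (subst (_∈ pos s ∷ stack) stack-root (lastOr-∈ (pos s) stack))

      w-unvisited : visited s w ≡ false
      w-unvisited with visited s w in w-vis
      ... | false = refl
      ... | true  with to (visited-reached w) w-vis
      ...   | inj₁ w-col = ⊥-elim (w-col w-unc)
      ...   | inj₂ w≡p   = ⊥-elim (w∉ (here w≡p))

      one-fewer : unvisited s ≡ suc (unvisited (moved s (ownColour s) w))
      one-fewer = count-drop (cong not w-unvisited) (cong not (update-≡ (visited s) w true))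
                             (λ v v≢w → cong not (sym (update-≢ (visited s) true v≢w)))

      decrease : measure I′ < measure I
      decrease = subst (λ u → measure I′ < 2 * u + length stack) (sym one-fewer)
                       (≤-reflexive (suc[2u+1+L]≡2[1+u]+L _ _))

  ascend-step : ∀ {s w} (I : DfsInvariant s) → Adj G (pos s) w → environment s 0 ≡ 0 →
                color s w ≡ prev (ownColour s) →
                Σ (DfsInvariant (moved s (ownColour s) w)) λ I′ → measure I′ < measure I
  ascend-step {s} I p~w no-uncoloured w-prev
    with Neighbourhood.parent-neighbour I p~w (trans w-prev (cong prev (ownColour-shade I)))
  ascend-step {s} {x} I@record { stack = .x ∷ T ; stack-unique = _ ∷ x-unique
                               ; stack-path = p~x ∷ x-path ; stack-coloured = x-col ∷ T-col
                               ; stack-depth = p-step ∷ x-depth }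
              _ no-uncoloured _ | refl = I′ , decrease
    where
      open Neighbourhood I
      open Recolouring (color s) (pos s) (ownColour≢0 I)
      parent′ = update parent (pos s) x

      colour-shade′ : ∀ v → Coloured col′ v → col′ v ≡ shade (depth v)
      colour-shade′ v v-col′ with v ≟ pos s
      ... | yes refl = ownColour-shade I
      ... | no _     = colour-shade v v-col′

      off-stack : ∀ {v} → v ∉ x ∷ T → v ≢ pos s → v ∉ pos s ∷ x ∷ T
      off-stack _  v≢p (here v≡p) = v≢p v≡p
      off-stack v∉ _   (there v∈) = v∉ v∈

      finished-parent′ : ∀ v → Finished col′ (x ∷ T) v → ParentEdge col′ depth v (parent′ v)
      finished-parent′ v v-fin′ with v ≟ pos s
      ... | yes refl = p~x , stays-coloured x-col , p-step
      ... | no v≢p   =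
        let v~par , par-col , v-step =
              finished-parent v (proj₁ v-fin′ , off-stack (proj₂ v-fin′) v≢p)
        in v~par , stays-coloured par-col , v-step

      finished-closed′ : ∀ v u → Finished col′ (x ∷ T) v → Adj G v u → Coloured col′ u
      finished-closed′ v u v-fin′ v~u with v ≟ pos s
      ... | yes refl = stays-coloured (env-zero G dfs-algorithm (color s) no-uncoloured v~u)
      ... | no v≢p   =
        stays-coloured (finished-closed v u (proj₁ v-fin′ , off-stack (proj₂ v-fin′) v≢p) v~u)

      I′ : DfsInvariant (moved s (ownColour s) x)
      I′ = record
        { stack           = T
        ; stack-root      = stack-root
        ; stack-unique    = x-unique
        ; stack-path      = x-path
        ; stack-coloured  = All.map stays-coloured T-col
        ; depth           = depth
        ; stack-depth     = x-depth
        ; depth-root      = depth-root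
        ; colour-shade    = colour-shade′
        ; parent          = parent′
        ; finished-parent = finished-parent′
        ; finished-closed = finished-closed′
        ; visited-reached = moved-visited-reached I (ownColour≢0 I) x
        }

      x-visited : visited s x ≡ true
      x-visited = from (visited-reached x) (inj₁ x-col)

      as-many : unvisited (moved s (ownColour s) x) ≡ unvisited s
      as-many = count-cong (λ v → cong not (update-redundant (visited s) x-visited v))

      decrease : measure I′ < measure I
      decrease = subst (λ u → 2 * u + length T < measure I) (sym as-many) (+-monoʳ-< _ ≤-refl)

  neighbour-keeps-colour : ∀ {s : DfsState} {w c} → Adj G (pos s) w →
                           update (color s) (pos s) c w ≡ color s w
  neighbour-keeps-colour {s} p~w = update-≢ (color s) _ (Adj⇒≢ G p~w ∘ sym)

  step-decreases : ∀ {s s′} → Step dfs-algorithm G s s′ → (I : DfsInvariant s) →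
                   Σ (DfsInvariant s′) λ I′ → measure I′ < measure I
  step-decreases {s} (step dec p~w w-colour) I
    with dfs-go (ownColour s) (environment s 0) (environment s (prev (ownColour s))) dec
  ... | descend _              = descend-step I p~w (trans (sym (neighbour-keeps-colour {s} p~w)) w-colour)
  ... | ascend no-uncoloured _ =
    ascend-step I p~w no-uncoloured (trans (sym (neighbour-keeps-colour {s} p~w)) w-colour)

  runs-finite : ∀ {s} (I : DfsInvariant s) → Acc _<_ (measure I) → AllRunsFinite dfs-algorithm G s
  runs-finite I (acc smaller) =
    acc λ s→s′ → let I′ , decrease = step-decreases s→s′ I
                 in runs-finite I′ (smaller decrease)

  reachable-invariant : ∀ {s s′} → DfsInvariant s → Reachable dfs-algorithm G s s′ →
                        DfsInvariant s′
  reachable-invariant I ε            = I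
  reachable-invariant I (s→ ◅ s→*) = reachable-invariant (proj₁ (step-decreases s→ I)) s→*

  initial-invariant : DfsInvariant (initial dfs-algorithm G root)
  initial-invariant = record
    { stack           = []
    ; stack-root      = refl
    ; stack-unique    = [] ∷ []
    ; stack-path      = [-]
    ; stack-coloured  = []
    ; depth           = λ _ → 0
    ; stack-depth     = [-]
    ; depth-root      = refl
    ; colour-shade    = λ _ v-col → ⊥-elim (v-col refl)
    ; parent          = λ v → v
    ; finished-parent = λ _ v-fin → ⊥-elim (proj₁ v-fin refl)
    ; finished-closed = λ _ _ v-fin _ → ⊥-elim (proj₁ v-fin refl)
    ; visited-reached = λ v → mk⇔ (only-root v ∘ to (update-true _ root v))
                                  (from (update-true _ root v) ∘ only-root′ v)
    }
    where
      only-root : ∀ v → false ≡ true ⊎ v ≡ root → Reached (λ _ → 0) root v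
      only-root v (inj₂ v≡root) = inj₂ v≡root
      only-root′ : ∀ v → Reached (λ _ → 0) root v → false ≡ true ⊎ v ≡ root
      only-root′ v (inj₁ v-col)  = ⊥-elim (v-col refl)
      only-root′ v (inj₂ v≡root) = inj₂ v≡root

  stopped-at-root : Connected G → ∀ {s} (I : DfsInvariant s) → environment s 0 ≡ 0 →
                    environment s (prev (ownColour s)) ≡ 0 →
                    pos s ≡ root × (∀ v → visited s v ≡ true)
  stopped-at-root _ {s} I@record { stack = x ∷ _ ; stack-path = p~x ∷ _ ; stack-coloured = x-col ∷ _
                                  ; stack-depth = p-step ∷ _ } _ no-parent =
    ⊥-elim (env-zero G dfs-algorithm (color s) no-parent p~x x-parent)
    where
      open Neighbourhood I
      x-parent : color s x ≡ prev (ownColour s)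
      x-parent = trans (colour-shade x x-col)
        (sym (trans (cong prev (trans (ownColour-shade I) (cong shade p-step)))
                    (prev-next (shade-colour (depth x)))))
  stopped-at-root connected {s} I@record { stack = [] ; stack-root = p≡root } no-uncoloured _ =
    p≡root , λ v → from (visited-reached v) (walk-reached (connected (pos s) v) (inj₂ refl))
    where
      open Neighbourhood I
      closed : ∀ {u v} → Reached (color s) (pos s) u → Adj G u v → Reached (color s) (pos s) v
      closed {u} u-reached u~v with u ≟ pos s | u-reached
      ... | yes refl | _          = inj₁ (env-zero G dfs-algorithm (color s) no-uncoloured u~v)
      ... | no u≢p   | inj₂ u≡p   = ⊥-elim (u≢p u≡p)
      ... | no u≢p   | inj₁ u-col =
        inj₁ (finished-closed u _ (u-col , λ { (here u≡p) → u≢p u≡p }) u~v)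
      walk-reached : ∀ {u v} → Walk G u v → Reached (color s) (pos s) u → Reached (color s) (pos s) v
      walk-reached here              u-reached = u-reached
      walk-reached (step u~u′ u′→v) u-reached = walk-reached u′→v (closed u-reached u~u′)

  colours≤3 : ∀ {s} → DfsInvariant s → ∀ v → color s v ≤ 3
  colours≤3 {s} I v with color s v ℕ.≟ 0
  ... | yes v-unc = ≤-trans (≤-reflexive v-unc) z≤n
  ... | no v-col  = subst (_≤ 3) (sym (colour-shade v v-col)) (colour≤3 (shade-colour (depth v)))
    where open DfsInvariant I

theorem1 : Σ Algorithm λ A → ∀ (G : Graph) → Tree G → SuccessfullyExplores A G × ColorsWithin3 A G
theorem1 = dfs-algorithm , λ G (connected , acyclic) →
    (λ v₀ → let open Exploration G acyclic v₀ in
        runs-finite initial-invariant (<-wellFounded _)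
      , λ s v₀→s stopped →
          let I = reachable-invariant initial-invariant v₀→s
              no-uncoloured , no-parent = dfs-stop (ownColour s) _ _ stopped
          in stopped-at-root connected I no-uncoloured no-parent)
  , λ v₀ s v₀→s → let open Exploration G acyclic v₀
                   in colours≤3 (reachable-invariant initial-invariant v₀→s)
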